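{- Let $d\in\{1,2,3,7,11\}$ and suppose that $z=[a_0;a_1,a_2,\ldots]$ with $a_n\in\mathbb{Z}[\omega_d]$ for $n\ge0$ is a geodesic continued fraction expansion. Then for every $n\ge1$: (i) $|a_n|\ne1$; (ii) $|a_n|=\sqrt2$ implies $a_{n+1}\ne-\overline{a_n}$; (iii) if $\zeta$ is a unit of $\mathbb{Z}[\omega_d]$, then $a_n=2\zeta$ implies $a_{n+1}\ne-2\overline\zeta$.
   Context: $\omega_d=\sqrt{ -d}$ for $d\in\{1,2\}$, $\omega_d=\frac{1+\sqrt{ -d}}2$ for $d\in\{3,7,11\}$. $[a_0;a_1,\ldots,a_n]=a_0+\cfrac1{a_1+\cfrac1{\ddots+\cfrac1{a_n}}}$; convergents $\frac{p_n}{q_n}=[a_0;a_1,\ldots,a_n]$. The Farey graph $\mathcal{E}_d$ has vertex set $\mathbb{Q}(\sqrt{ -d})\cup\{\infty\}$ and edges $A(\infty)\to A(0)$, $A\in\mathrm{PSL}(2,\mathbb{Z}[\omega_d])$ acting by Möbius transformations. A geodesic path is a walk of minimal length between its endpoints; the expansion is geodesic if $\infty\to\frac{p_0}{q_0}\to\cdots\to\frac{p_n}{q_n}$ is a geodesic path in $\mathcal{E}_d$ for every $n\ge0$. -}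

module Defs where

open import Data.Nat as ℕ using (ℕ; zero; suc)
open import Data.Nat.DivMod using (_%_; _/_)
open import Data.Integer as ℤ using (ℤ; +_; ∣_∣)
open import Data.Rational as ℚ using (ℚ)
open import Data.Product using (_×_; _,_; Σ; ∃)
open import Data.Maybe using (Maybe; just; nothing)
open import Data.List using (List; []; _∷_; length; map; upTo)
open import Data.Unit using (⊤)
open import Relation.Binary.PropositionalEquality using (_≡_)

-- The ring Z[ω_d].  ω_d satisfies ω² = t ω − m where
--   d ≡ 3 (mod 4): ω = (1+√-d)/2, t = 1, m = (1+d)/4   (d = 3, 7, 11)
--   otherwise    : ω = √-d,       t = 0, m = d         (d = 1, 2)
-- An element x + y ω (x, y ∈ ℤ) is represented by the pair (x , y);
-- {1, ω} is a ℤ-basis, so equality of elements is equality of pairs.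

tr : ℕ → ℤ
tr d with d % 4
... | 3 = + 1
... | _ = + 0

nm : ℕ → ℤ
nm d with d % 4
... | 3 = + ((1 ℕ.+ d) / 4)
... | _ = + d

Zω : Set
Zω = ℤ × ℤ

zeroω oneω : Zω
zeroω = (+ 0 , + 0)
oneω  = (+ 1 , + 0)

addω : Zω → Zω → Zω
addω (x₁ , y₁) (x₂ , y₂) = (x₁ ℤ.+ x₂ , y₁ ℤ.+ y₂)

negω : Zω → Zω
negω (x , y) = (ℤ.- x , ℤ.- y)

subω : Zω → Zω → Zω
subω u v = addω u (negω v)

-- (x₁ + y₁ω)(x₂ + y₂ω) = x₁x₂ − m y₁y₂ + (x₁y₂ + x₂y₁ + t y₁y₂) ω
mulω : ℕ → Zω → Zω → Zω
mulω d (x₁ , y₁) (x₂ , y₂) =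
  ( x₁ ℤ.* x₂ ℤ.- nm d ℤ.* (y₁ ℤ.* y₂)
  , x₁ ℤ.* y₂ ℤ.+ x₂ ℤ.* y₁ ℤ.+ tr d ℤ.* (y₁ ℤ.* y₂) )

scaleω : ℤ → Zω → Zω
scaleω k (x , y) = (k ℤ.* x , k ℤ.* y)

-- complex conjugation: conj(ω) = t − ω
conjω : ℕ → Zω → Zω
conjω d (x , y) = (x ℤ.+ tr d ℤ.* y , ℤ.- y)

-- N(z) = z * conj z = |z|² = x² + t x y + m y²
normω : ℕ → Zω → ℤ
normω d (x , y) = x ℤ.* x ℤ.+ tr d ℤ.* (x ℤ.* y) ℤ.+ nm d ℤ.* (y ℤ.* y)

IsUnit : ℕ → Zω → Set
IsUnit d ζ = ∃ λ η → mulω d ζ η ≡ oneω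

-- The field Q(√-d) = {r + s ω : r, s ∈ ℚ}, represented by (r , s);
-- vertices of the Farey graph: Q(√-d) ∪ {∞}, ∞ = nothing.

K : Set
K = ℚ × ℚ

Vertex : Set
Vertex = Maybe K

-- the vertex a / c for a, c ∈ Z[ω_d] (∞ when c = 0).
-- a / c = a * conj(c) / N(c); N(c) = 0 iff c = 0 (positive definite norm).
frac : ℕ → Zω → Zω → Vertex
frac d a c with ∣ normω d c ∣ | mulω d a (conjω d c)
... | zero  | _       = nothing
... | suc k | (x , y) = just (x ℚ./ suc k , y ℚ./ suc k)

-- Edges of the Farey graph E_d: A(∞) → A(0) for A = [[α, β], [γ, δ]]
-- in SL(2, Z[ω_d]) (same Möbius maps as PSL); A(∞) = α/γ, A(0) = β/δ.
Edge : ℕ → Vertex → Vertex → Set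
Edge d u v = Σ Zω λ α → Σ Zω λ β → Σ Zω λ γ → Σ Zω λ δ →
  (subω (mulω d α δ) (mulω d β γ) ≡ oneω) × (u ≡ frac d α γ) × (v ≡ frac d β δ)

-- A walk is a start vertex u followed by the list of subsequent vertices;
-- its length is the number of edges = length of that list.
IsWalkFrom : ℕ → Vertex → List Vertex → Set
IsWalkFrom d u []       = ⊤
IsWalkFrom d u (v ∷ vs) = Edge d u v × IsWalkFrom d v vs

endpoint : Vertex → List Vertex → Vertex
endpoint u []       = u
endpoint u (v ∷ vs) = endpoint v vs

IsGeodesic : ℕ → Vertex → List Vertex → Set
IsGeodesic d u vs = IsWalkFrom d u vs ×
  ((ws : List Vertex) → IsWalkFrom d u ws → endpoint u ws ≡ endpoint u vs →
     length vs ℕ.≤ length ws)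

-- Convergents p_n / q_n of [a₀; a₁, a₂, …]:
-- p_{-1} = 1, q_{-1} = 0, p₀ = a₀, q₀ = 1,
-- p_n = a_n p_{n-1} + p_{n-2},  q_n = a_n q_{n-1} + q_{n-2}.
-- pq d a n = (p_n , q_n , p_{n-1} , q_{n-1})
pq : ℕ → (ℕ → Zω) → ℕ → Zω × Zω × Zω × Zω
pq d a zero = (a 0 , oneω , oneω , zeroω)
pq d a (suc n) with pq d a n
... | (p , q , p' , q') =
  (addω (mulω d (a (suc n)) p) p' , addω (mulω d (a (suc n)) q) q' , p , q)

convergent : ℕ → (ℕ → Zω) → ℕ → Vertex
convergent d a n with pq d a n
... | (p , q , _ , _) = frac d p q

GeodesicExpansion : ℕ → (ℕ → Zω) → Set
GeodesicExpansion d a =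
  (n : ℕ) → IsGeodesic d nothing (map (convergent d a) (upTo (suc n)))

-- Write u_k = (p_k, q_k), so u_{k+1} = a_{k+1} u_k + u_{k-1}. Consecutive columns have
-- det(u_{k-1}, u_k) = ±1, and the recurrence turns det(u_{k-1}, ·) of later columns into explicit
-- multiples of it: a_{k+1} for u_{k+1} and 1 + a_{k+2} a_{k+1} for u_{k+2}. Two columns whose
-- determinant has norm 1 span an edge of the Farey graph. So |a_n| = 1 joins p_{n-2}/q_{n-2} to
-- p_n/q_n directly; a_{n+1} = -conj a_n with |a_n|² = 2 gives 1 + a_{n+1} a_n = 1 - |a_n|² = -1 and
-- joins p_{n-2}/q_{n-2} to p_{n+1}/q_{n+1}; and for a_n = 2ζ, a_{n+1} = -2 conj ζ the column
-- conj ζ u_{n-2} + u_{n-1} is adjacent to both p_{n-2}/q_{n-2} and p_{n+1}/q_{n+1}. Each shortcut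
-- makes a walk from ∞ to a convergent shorter than the expansion path, contradicting geodesicity.

module Submission where

open import Defs
open import Data.Nat using (ℕ; suc; _≤_)
open import Data.Integer using (+_)
open import Data.Product using (_×_)
open import Data.Sum using (_⊎_)
open import Relation.Binary.PropositionalEquality using (_≡_; _≢_)

open import Data.Nat as ℕ using (zero; z≤n; s≤s; _<_)
import Data.Nat.Properties as ℕP
open import Data.Nat.DivMod using (_%_; m%n≤m; m≥n⇒m/n>0)
open import Data.Integer as ℤ using (ℤ; -[1+_]; +≤+; ∣_∣)
import Data.Integer.Properties as ℤP
open import Data.Integer.Solver using (module +-*-Solver)
open +-*-Solver using (Polynomial; _:+_; _:*_; :-_; _:-_; con; var; prove; ⟦_⟧; ⟦_⟧↓)
open import Data.Fin using (Fin; zero; suc)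
open import Data.Product as Prod using (_,_; proj₁; proj₂)
open import Data.Vec as Vec using (Vec; []; _∷_)
open import Data.List using (List; []; _∷_; _++_; [_]; map; upTo; length)
import Data.List.Properties as ListP
open import Data.Maybe using (nothing)
open import Data.Unit using (tt)
open import Relation.Binary.PropositionalEquality
  using (refl; sym; trans; cong; cong₂; subst; subst₂; module ≡-Reasoning)

Zω² : Set
Zω² = Zω × Zω

vertex : ℕ → Zω² → Vertex
vertex d (p , q) = frac d p q

det : ℕ → Zω² → Zω² → Zω
det d (α , γ) (β , δ) = subω (mulω d α δ) (mulω d β γ)

step : ℕ → Zω → Zω² → Zω² → Zω²
step d x (p , q) (p′ , q′) = addω (mulω d x p) p′ , addω (mulω d x q) q′

scale² : ℕ → Zω → Zω² → Zω²
scale² d x (p , q) = mulω d x p , mulω d x q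

coordinates : ∀ {k} → Fin k → Fin (k ℕ.* 2) × Fin (k ℕ.* 2)
coordinates zero    = zero , suc zero
coordinates (suc i) = Prod.map (λ j → suc (suc j)) (λ j → suc (suc j)) (coordinates i)

-- The operations of Defs replayed on pairs of integer polynomials whose variables 0 and 1 stand
-- for tr d and nm d and the others for the coordinates of k elements of Z[ω]. Evaluating a
-- symbolic term gives back the concrete one definitionally, so identities in Z[ω] reduce to
-- integer polynomial identities, one per coordinate, which the ring solver decides.
module Symbolic (k : ℕ) where

  Sym : Set
  Sym = Polynomial (2 ℕ.+ k ℕ.* 2)

  Ω : Set
  Ω = Sym × Sym

  t m : Sym
  t = var zero
  m = var (suc zero)

  infixl 7 _⊗_
  infixl 6 _⊕_ _⊝_

  _⊕_ _⊝_ _⊗_ : Ω → Ω → Ω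
  (x₁ , y₁) ⊕ (x₂ , y₂) = x₁ :+ x₂ , y₁ :+ y₂
  u ⊝ (x , y) = u ⊕ (:- x , :- y)
  (x₁ , y₁) ⊗ (x₂ , y₂) =
    x₁ :* x₂ :- m :* (y₁ :* y₂) , x₁ :* y₂ :+ x₂ :* y₁ :+ t :* (y₁ :* y₂)

  ⊖_ conj : Ω → Ω
  ⊖ (x , y) = :- x , :- y
  conj (x , y) = x :+ t :* y , :- y

  ι : ℤ → Ω
  ι n = con n , con (+ 0)

  _·_ : ℤ → Ω → Ω
  n · (x , y) = con n :* x , con n :* y

  norm : Ω → Sym
  norm (x , y) = x :* x :+ t :* (x :* y) :+ m :* (y :* y)

  Ω² : Set
  Ω² = Ω × Ω

  det′ : Ω² → Ω² → Ω
  det′ (α , γ) (β , δ) = α ⊗ δ ⊝ β ⊗ γ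

  step′ : Ω → Ω² → Ω² → Ω²
  step′ x (p , q) (p′ , q′) = x ⊗ p ⊕ p′ , x ⊗ q ⊕ q′

  variables : Vec Ω k
  variables = Vec.tabulate λ i →
    Prod.map (λ j → var (suc (suc j))) (λ j → var (suc (suc j))) (coordinates i)

  environment : ℕ → Vec Zω k → Vec ℤ (2 ℕ.+ k ℕ.* 2)
  environment d xs = tr d ∷ nm d ∷ Vec.concat (Vec.map (λ x → proj₁ x ∷ proj₂ x ∷ []) xs)

  solveℤ : ∀ d xs (f : Vec Ω k → Sym × Sym) → let (p , q) = f variables in
    ⟦ p ⟧↓ (environment d xs) ≡ ⟦ q ⟧↓ (environment d xs) →
    ⟦ p ⟧ (environment d xs) ≡ ⟦ q ⟧ (environment d xs)
  solveℤ d xs f = prove (environment d xs) (proj₁ (f variables)) (proj₂ (f variables))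

  solveω : ∀ d xs (f : Vec Ω k → Ω × Ω) → let ((p₁ , p₂) , (q₁ , q₂)) = f variables in
    ⟦ p₁ ⟧↓ (environment d xs) ≡ ⟦ q₁ ⟧↓ (environment d xs) →
    ⟦ p₂ ⟧↓ (environment d xs) ≡ ⟦ q₂ ⟧↓ (environment d xs) →
    (⟦ p₁ ⟧ (environment d xs) , ⟦ p₂ ⟧ (environment d xs))
      ≡ (⟦ q₁ ⟧ (environment d xs) , ⟦ q₂ ⟧ (environment d xs))
  solveω d xs f e₁ e₂ = cong₂ _,_
    (prove (environment d xs) (proj₁ (proj₁ (f variables))) (proj₁ (proj₂ (f variables))) e₁)
    (prove (environment d xs) (proj₂ (proj₁ (f variables))) (proj₂ (proj₂ (f variables))) e₂)

module _ (d : ℕ) where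

  norm-zero : normω d zeroω ≡ + 0
  norm-zero = solveℤ d [] (λ where [] → norm (ι (+ 0)) , con (+ 0)) refl
    where open Symbolic 0

  norm-one : normω d oneω ≡ + 1
  norm-one = solveℤ d [] (λ where [] → norm (ι (+ 1)) , con (+ 1)) refl
    where open Symbolic 0

  norm-neg : ∀ x → normω d (negω x) ≡ normω d x
  norm-neg x = solveℤ d (x ∷ []) (λ where (X ∷ []) → norm (⊖ X) , norm X) refl
    where open Symbolic 1

  norm-conj : ∀ x → normω d (conjω d x) ≡ normω d x
  norm-conj x = solveℤ d (x ∷ []) (λ where (X ∷ []) → norm (conj X) , norm X) refl
    where open Symbolic 1

  norm-* : ∀ x y → normω d (mulω d x y) ≡ normω d x ℤ.* normω d y
  norm-* x y = solveℤ d (x ∷ y ∷ []) (λ where (X ∷ Y ∷ []) → norm (X ⊗ Y) , norm X :* norm Y) refl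
    where open Symbolic 2

  conj-*-self : ∀ x → mulω d (conjω d x) x ≡ (normω d x , + 0)
  conj-*-self x = solveω d (x ∷ []) (λ where (X ∷ []) → conj X ⊗ X , (norm X , con (+ 0))) refl refl
    where open Symbolic 1

  *-conj-*-scale : ∀ v x y →
    mulω d (mulω d v x) (conjω d (mulω d v y)) ≡ scaleω (normω d v) (mulω d x (conjω d y))
  *-conj-*-scale v x y = solveω d (v ∷ x ∷ y ∷ [])
    (λ where (V ∷ X ∷ Y ∷ []) → V ⊗ X ⊗ conj (V ⊗ Y) , (norm V :* proj₁ (X ⊗ conj Y) , norm V :* proj₂ (X ⊗ conj Y)))
    refl refl
    where open Symbolic 3

  four-norm : ∀ x → + 4 ℤ.* normω d x
    ≡ (+ 2 ℤ.* proj₁ x ℤ.+ tr d ℤ.* proj₂ x) ℤ.* (+ 2 ℤ.* proj₁ x ℤ.+ tr d ℤ.* proj₂ x)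
      ℤ.+ (+ 4 ℤ.* nm d ℤ.- tr d ℤ.* tr d) ℤ.* (proj₂ x ℤ.* proj₂ x)
  four-norm x = solveℤ d (x ∷ [])
    (λ where (X ∷ []) → let (X₁ , X₂) = X ; s = con (+ 2) :* X₁ :+ t :* X₂ in
               con (+ 4) :* norm X , s :* s :+ (con (+ 4) :* m :- t :* t) :* (X₂ :* X₂))
    refl
    where open Symbolic 1

  norm-1-conj-* : ∀ x →
    normω d (addω oneω (mulω d (negω (conjω d x)) x))
      ≡ (+ 1 ℤ.- normω d x) ℤ.* (+ 1 ℤ.- normω d x)
  norm-1-conj-* x = solveℤ d (x ∷ [])
    (λ where (X ∷ []) → norm (ι (+ 1) ⊕ ⊖ conj X ⊗ X) ,
                        (con (+ 1) :- norm X) :* (con (+ 1) :- norm X))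
    refl
    where open Symbolic 1

  norm-twice-unit-coefficient : ∀ z → let c = conjω d z ; x = scaleω (+ 2) z ; y = negω (scaleω (+ 2) c) in
    normω d (subω (mulω d c (addω oneω (mulω d y x))) y)
      ≡ normω d z ℤ.* ((+ 3 ℤ.- + 4 ℤ.* normω d z) ℤ.* (+ 3 ℤ.- + 4 ℤ.* normω d z))
  norm-twice-unit-coefficient z = solveℤ d (z ∷ [])
    (λ where (Z ∷ []) → let C = conj Z ; X = (+ 2) · Z ; Y = ⊖ ((+ 2) · C) in
               norm (C ⊗ (ι (+ 1) ⊕ Y ⊗ X) ⊝ Y) ,
               norm Z :* ((con (+ 3) :- con (+ 4) :* norm Z) :* (con (+ 3) :- con (+ 4) :* norm Z)))
    refl
    where open Symbolic 1

  det-initial : ∀ x → det d (oneω , zeroω) (x , oneω) ≡ oneω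
  det-initial x = solveω d (x ∷ []) (λ where (X ∷ []) → det′ (ι (+ 1) , ι (+ 0)) (X , ι (+ 1)) , ι (+ 1))
    refl refl
    where open Symbolic 1

  det-scale²ʳ : ∀ x u w → det d u (scale² d x w) ≡ mulω d x (det d u w)
  det-scale²ʳ x u w = solveω d (x ∷ proj₁ u ∷ proj₂ u ∷ proj₁ w ∷ proj₂ w ∷ [])
    (λ where (X ∷ U₁ ∷ U₂ ∷ W₁ ∷ W₂ ∷ []) → det′ (U₁ , U₂) (X ⊗ W₁ , X ⊗ W₂) , X ⊗ det′ (U₁ , U₂) (W₁ , W₂))
    refl refl
    where open Symbolic 5

  det-step : ∀ x u v → det d v (step d x v u) ≡ negω (det d u v)
  det-step x u v = solveω d (x ∷ proj₁ u ∷ proj₂ u ∷ proj₁ v ∷ proj₂ v ∷ [])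
    (λ where (X ∷ U₁ ∷ U₂ ∷ V₁ ∷ V₂ ∷ []) → let U = (U₁ , U₂) ; V = (V₁ , V₂) in
               det′ V (step′ X V U) , ⊖ det′ U V)
    refl refl
    where open Symbolic 5

  det-step-absorb : ∀ x u v → det d u (step d x u v) ≡ det d u v
  det-step-absorb x u v = solveω d (x ∷ proj₁ u ∷ proj₂ u ∷ proj₁ v ∷ proj₂ v ∷ [])
    (λ where (X ∷ U₁ ∷ U₂ ∷ V₁ ∷ V₂ ∷ []) → let U = (U₁ , U₂) ; V = (V₁ , V₂) in
               det′ U (step′ X U V) , det′ U V)
    refl refl
    where open Symbolic 5

  det-step-skip : ∀ x u v → det d u (step d x v u) ≡ mulω d x (det d u v)
  det-step-skip x u v = solveω d (x ∷ proj₁ u ∷ proj₂ u ∷ proj₁ v ∷ proj₂ v ∷ [])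
    (λ where (X ∷ U₁ ∷ U₂ ∷ V₁ ∷ V₂ ∷ []) → let U = (U₁ , U₂) ; V = (V₁ , V₂) in
               det′ U (step′ X V U) , X ⊗ det′ U V)
    refl refl
    where open Symbolic 5

  det-step-skip² : ∀ x y u v →
    det d u (step d y (step d x v u) v) ≡ mulω d (addω oneω (mulω d y x)) (det d u v)
  det-step-skip² x y u v = solveω d (x ∷ y ∷ proj₁ u ∷ proj₂ u ∷ proj₁ v ∷ proj₂ v ∷ [])
    (λ where (X ∷ Y ∷ U₁ ∷ U₂ ∷ V₁ ∷ V₂ ∷ []) → let U = (U₁ , U₂) ; V = (V₁ , V₂) in
               det′ U (step′ Y (step′ X V U) V) , (ι (+ 1) ⊕ Y ⊗ X) ⊗ det′ U V)
    refl refl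
    where open Symbolic 6

  det-absorb-skip² : ∀ c x y u v →
    det d (step d c u v) (step d y (step d x v u) v)
      ≡ mulω d (subω (mulω d c (addω oneω (mulω d y x))) y) (det d u v)
  det-absorb-skip² c x y u v = solveω d (c ∷ x ∷ y ∷ proj₁ u ∷ proj₂ u ∷ proj₁ v ∷ proj₂ v ∷ [])
    (λ where (C ∷ X ∷ Y ∷ U₁ ∷ U₂ ∷ V₁ ∷ V₂ ∷ []) → let U = (U₁ , U₂) ; V = (V₁ , V₂) in
               det′ (step′ C U V) (step′ Y (step′ X V U) V) , (C ⊗ (ι (+ 1) ⊕ Y ⊗ X) ⊝ Y) ⊗ det′ U V)
    refl refl
    where open Symbolic 7

square-nonneg : ∀ i → + 0 ℤ.≤ i ℤ.* i
square-nonneg (+ n)    = subst (+ 0 ℤ.≤_) (sym (ℤP.+◃n≡+n (n ℕ.* n))) (+≤+ z≤n)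
square-nonneg -[1+ n ] = +≤+ z≤n

private
  four-n-nonneg : ∀ n → + 0 ℤ.≤ + 4 ℤ.* + n ℤ.- + 0 ℤ.* + 0
  four-n-nonneg zero    = +≤+ z≤n
  four-n-nonneg (suc _) = +≤+ z≤n

  four-n-1-nonneg : ∀ {n} → 0 < n → + 0 ℤ.≤ + 4 ℤ.* + n ℤ.- + 1 ℤ.* + 1
  four-n-1-nonneg (s≤s _) = +≤+ z≤n

discriminant-nonneg : ∀ d → + 0 ℤ.≤ + 4 ℤ.* nm d ℤ.- tr d ℤ.* tr d
discriminant-nonneg d with d % 4 in d%4≡r
... | 0 = four-n-nonneg d
... | 1 = four-n-nonneg d
... | 2 = four-n-nonneg d
... | 3 = four-n-1-nonneg (m≥n⇒m/n>0 (s≤s (subst (ℕ._≤ d) d%4≡r (m%n≤m d 4))))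
... | suc (suc (suc (suc _))) = four-n-nonneg d

norm-nonneg : ∀ d x → + 0 ℤ.≤ normω d x
norm-nonneg d x = ℤP.*-cancelˡ-≤-pos (+ 0) (normω d x) (+ 4)
  (subst (+ 0 ℤ.≤_) (sym (four-norm d x))
    (ℤP.+-mono-≤ (square-nonneg s)
      (ℤP.*-monoʳ-≤-nonNeg (y ℤ.* y) {{ℤ.nonNegative (square-nonneg y)}} (discriminant-nonneg d))))
  where
  s = + 2 ℤ.* proj₁ x ℤ.+ tr d ℤ.* proj₂ x
  y = proj₂ x

unit-norm : ∀ d ζ → IsUnit d ζ → normω d ζ ≡ + 1
unit-norm d ζ (η , ζη≡1) = begin
  normω d ζ       ≡⟨ sym (ℤP.0≤i⇒+∣i∣≡i (norm-nonneg d ζ)) ⟩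
  + ∣ normω d ζ ∣ ≡⟨ cong +_ (ℕP.m*n≡1⇒m≡1 _ _ ∣Nζ∣*∣Nη∣≡1) ⟩
  + 1             ∎
  where
  open ≡-Reasoning
  ∣Nζ∣*∣Nη∣≡1 : ∣ normω d ζ ∣ ℕ.* ∣ normω d η ∣ ≡ 1
  ∣Nζ∣*∣Nη∣≡1 = begin
    ∣ normω d ζ ∣ ℕ.* ∣ normω d η ∣   ≡⟨ sym (ℤP.abs-* (normω d ζ) (normω d η)) ⟩
    ∣ normω d ζ ℤ.* normω d η ∣       ≡⟨ cong ∣_∣ (sym (norm-* d ζ η)) ⟩
    ∣ normω d (mulω d ζ η) ∣          ≡⟨ cong (λ z → ∣ normω d z ∣) ζη≡1 ⟩
    ∣ normω d oneω ∣                  ≡⟨ cong ∣_∣ (norm-one d) ⟩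
    1                                 ∎

frac-cong : ∀ d {a c a′ c′} → ∣ normω d c ∣ ≡ ∣ normω d c′ ∣ →
  mulω d a (conjω d c) ≡ mulω d a′ (conjω d c′) → frac d a c ≡ frac d a′ c′
frac-cong d eN eM rewrite eN | eM = refl

frac-norm≡0 : ∀ d a c → normω d c ≡ + 0 → frac d a c ≡ nothing
frac-norm≡0 d a c eN rewrite eN = refl

scale-one : ∀ z → scaleω (+ 1) z ≡ z
scale-one (x , y) = cong₂ _,_ (ℤP.*-identityˡ x) (ℤP.*-identityˡ y)

vertex-scale² : ∀ d {x} w → normω d x ≡ + 1 → vertex d (scale² d x w) ≡ vertex d w
vertex-scale² d {x} (p , q) Nx≡1 = frac-cong d {mulω d x p} {mulω d x q} {p} {q} (cong ∣_∣ norm-xq) (begin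
  mulω d (mulω d x p) (conjω d (mulω d x q)) ≡⟨ *-conj-*-scale d x p q ⟩
  scaleω (normω d x) (mulω d p (conjω d q))   ≡⟨ cong (λ n → scaleω n (mulω d p (conjω d q))) Nx≡1 ⟩
  scaleω (+ 1) (mulω d p (conjω d q))         ≡⟨ scale-one (mulω d p (conjω d q)) ⟩
  mulω d p (conjω d q)                        ∎)
  where
  open ≡-Reasoning
  norm-xq : normω d (mulω d x q) ≡ normω d q
  norm-xq = begin
    normω d (mulω d x q)       ≡⟨ norm-* d x q ⟩
    normω d x ℤ.* normω d q    ≡⟨ cong (ℤ._* normω d q) Nx≡1 ⟩
    + 1 ℤ.* normω d q          ≡⟨ ℤP.*-identityˡ (normω d q) ⟩
    normω d q                  ∎

-- Rescaling w by conj (det u w), a number of norm 1, makes the determinant exactly 1.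
norm-det≡1⇒Edge : ∀ d u w → normω d (det d u w) ≡ + 1 → Edge d (vertex d u) (vertex d w)
norm-det≡1⇒Edge d u w N≡1 =
  proj₁ u , proj₁ w′ , proj₂ u , proj₂ w′ , det≡1 , refl ,
  sym (vertex-scale² d {conjω d ε} w (trans (norm-conj d ε) N≡1))
  where
  open ≡-Reasoning
  ε = det d u w
  w′ = scale² d (conjω d ε) w
  det≡1 : det d u w′ ≡ oneω
  det≡1 = begin
    det d u w′                 ≡⟨ det-scale²ʳ d (conjω d ε) u w ⟩
    mulω d (conjω d ε) ε       ≡⟨ conj-*-self d ε ⟩
    (normω d ε , + 0)          ≡⟨ cong (_, + 0) N≡1 ⟩
    oneω                       ∎

endpoint-++ : ∀ u xs ys → endpoint u (xs ++ ys) ≡ endpoint (endpoint u xs) ys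
endpoint-++ u []       ys = refl
endpoint-++ u (x ∷ xs) ys = endpoint-++ x xs ys

walk-++ : ∀ {d u} xs {ys} → IsWalkFrom d u xs → IsWalkFrom d (endpoint u xs) ys →
  IsWalkFrom d u (xs ++ ys)
walk-++ []       _        w₂ = w₂
walk-++ (x ∷ xs) (e , w₁) w₂ = e , walk-++ xs w₁ w₂

geodesic-≤-++ : ∀ {d u vs} xs {ys} → IsGeodesic d u vs →
  IsWalkFrom d u xs → IsWalkFrom d (endpoint u xs) ys → endpoint (endpoint u xs) ys ≡ endpoint u vs →
  length vs ≤ length xs ℕ.+ length ys
geodesic-≤-++ {u = u} {vs} xs {ys} (_ , minimal) w₁ w₂ ends =
  subst (length vs ≤_) (ListP.length-++ xs)
    (minimal (xs ++ ys) (walk-++ xs w₁ w₂) (trans (endpoint-++ u xs ys) ends))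

module Convergents (d : ℕ) (a : ℕ → Zω) where

  col col₋ : ℕ → Zω²
  col n  = proj₁ (pq d a n) , proj₁ (proj₂ (pq d a n))
  col₋ n = proj₂ (proj₂ (pq d a n))

  norm-det-col : ∀ n → normω d (det d (col₋ n) (col n)) ≡ + 1
  norm-det-col zero    = trans (cong (normω d) (det-initial d (a 0))) (norm-one d)
  norm-det-col (suc n) = begin
    normω d (det d (col n) (step d (a (suc n)) (col n) (col₋ n)))
      ≡⟨ cong (normω d) (det-step d (a (suc n)) (col₋ n) (col n)) ⟩
    normω d (negω (det d (col₋ n) (col n)))  ≡⟨ norm-neg d (det d (col₋ n) (col n)) ⟩
    normω d (det d (col₋ n) (col n))         ≡⟨ norm-det-col n ⟩
    + 1                                      ∎
    where open ≡-Reasoning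

  path : ℕ → List Vertex
  path n = map (convergent d a) (upTo n)

  length-path : ∀ n → length (path n) ≡ n
  length-path n = trans (ListP.length-map (convergent d a) (upTo n)) (ListP.length-upTo n)

  endpoint-path : ∀ n → endpoint nothing (path n) ≡ vertex d (col₋ n)
  endpoint-path zero    = sym (frac-norm≡0 d oneω zeroω (norm-zero d))
  endpoint-path (suc n) = begin
    endpoint nothing (path (suc n))
      ≡⟨ cong (λ ns → endpoint nothing (map (convergent d a) ns)) (sym (ListP.upTo-∷ʳ n)) ⟩
    endpoint nothing (map (convergent d a) (upTo n ++ [ n ]))
      ≡⟨ cong (endpoint nothing) (ListP.map-++ (convergent d a) (upTo n) [ n ]) ⟩
    endpoint nothing (path n ++ [ convergent d a n ])
      ≡⟨ endpoint-++ nothing (path n) [ convergent d a n ] ⟩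
    convergent d a n ∎
    where open ≡-Reasoning

  det≡unit*det-col⇒Edge : ∀ n u w x → normω d x ≡ + 1 →
    det d u w ≡ mulω d x (det d (col₋ n) (col n)) → Edge d (vertex d u) (vertex d w)
  det≡unit*det-col⇒Edge n u w x Nx≡1 det≡ = norm-det≡1⇒Edge d u w (begin
    normω d (det d u w)                            ≡⟨ cong (normω d) det≡ ⟩
    normω d (mulω d x (det d (col₋ n) (col n)))    ≡⟨ norm-* d x (det d (col₋ n) (col n)) ⟩
    normω d x ℤ.* normω d (det d (col₋ n) (col n)) ≡⟨ cong₂ ℤ._*_ Nx≡1 (norm-det-col n) ⟩
    + 1                                            ∎)
    where open ≡-Reasoning

module GeodesicExpansionProperties {d a} (geodesic : GeodesicExpansion d a) where

  open Convergents d a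
  open ≡-Reasoning

  walk-path : ∀ n → IsWalkFrom d nothing (path n)
  walk-path zero    = tt
  walk-path (suc n) = proj₁ (geodesic n)

  no-shortcut : ∀ j N zs → IsWalkFrom d (vertex d (col₋ j)) zs →
    endpoint (vertex d (col₋ j)) zs ≡ vertex d (col N) → N < length zs ℕ.+ j
  no-shortcut j N zs walk ends = subst₂ _≤_ (length-path (suc N)) (trans length-detour (ℕP.+-comm j _))
    (geodesic-≤-++ (path j) (geodesic N) (walk-path j)
      (subst (λ u → IsWalkFrom d u zs) (sym (endpoint-path j)) walk)
      (trans (cong (λ u → endpoint u zs) (endpoint-path j)) (trans ends (sym (endpoint-path (suc N))))))
    where
    length-detour : length (path j) ℕ.+ length zs ≡ j ℕ.+ length zs
    length-detour = cong (ℕ._+ length zs) (length-path j)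

  norm≢1 : ∀ k → normω d (a (suc k)) ≢ + 1
  norm≢1 k Nx≡1 = ℕP.<-irrefl refl (no-shortcut k (suc k) [ vertex d (col (suc k)) ] (edge , tt) refl)
    where
    edge : Edge d (vertex d (col₋ k)) (vertex d (col (suc k)))
    edge = det≡unit*det-col⇒Edge k (col₋ k) (col (suc k)) (a (suc k)) Nx≡1 (det-step-skip d (a (suc k)) (col₋ k) (col k))

  norm≡2⇒next≢-conj : ∀ k → normω d (a (suc k)) ≡ + 2 → a (suc (suc k)) ≢ negω (conjω d (a (suc k)))
  norm≡2⇒next≢-conj k Nx≡2 y≡-x̄ =
    ℕP.<⇒≱ (no-shortcut k (suc (suc k)) [ vertex d (col (suc (suc k))) ] (edge , tt) refl) (ℕP.n≤1+n (suc k))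
    where
    x = a (suc k)
    y = a (suc (suc k))
    coefficient-norm : normω d (addω oneω (mulω d y x)) ≡ + 1
    coefficient-norm = begin
      normω d (addω oneω (mulω d y x))
        ≡⟨ cong (λ b → normω d (addω oneω (mulω d b x))) y≡-x̄ ⟩
      normω d (addω oneω (mulω d (negω (conjω d x)) x))
        ≡⟨ norm-1-conj-* d x ⟩
      (+ 1 ℤ.- normω d x) ℤ.* (+ 1 ℤ.- normω d x)
        ≡⟨ cong (λ n → (+ 1 ℤ.- n) ℤ.* (+ 1 ℤ.- n)) Nx≡2 ⟩
      + 1 ∎
    edge : Edge d (vertex d (col₋ k)) (vertex d (col (suc (suc k))))
    edge = det≡unit*det-col⇒Edge k (col₋ k) (col (suc (suc k))) (addω oneω (mulω d y x)) coefficient-norm (det-step-skip² d x y (col₋ k) (col k))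

  twice-unit⇒next≢-twice-conj : ∀ k ζ → IsUnit d ζ → a (suc k) ≡ scaleω (+ 2) ζ →
    a (suc (suc k)) ≢ negω (scaleω (+ 2) (conjω d ζ))
  twice-unit⇒next≢-twice-conj k ζ unit x≡2ζ y≡-2ζ̄ =
    ℕP.<-irrefl refl (no-shortcut k (suc (suc k)) (vertex d w ∷ [ vertex d (col (suc (suc k))) ]) (edge₁ , edge₂ , tt) refl)
    where
    x = a (suc k)
    y = a (suc (suc k))
    c = conjω d ζ
    w = step d c (col₋ k) (col k)
    edge₁ : Edge d (vertex d (col₋ k)) (vertex d w)
    edge₁ = norm-det≡1⇒Edge d (col₋ k) w
      (trans (cong (normω d) (det-step-absorb d c (col₋ k) (col k))) (norm-det-col k))
    coefficient-norm : normω d (subω (mulω d c (addω oneω (mulω d y x))) y) ≡ + 1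
    coefficient-norm = begin
      normω d (subω (mulω d c (addω oneω (mulω d y x))) y)
        ≡⟨ cong₂ (λ x y → normω d (subω (mulω d c (addω oneω (mulω d y x))) y)) x≡2ζ y≡-2ζ̄ ⟩
      normω d (subω (mulω d c (addω oneω (mulω d (negω (scaleω (+ 2) c)) (scaleω (+ 2) ζ))))
                    (negω (scaleω (+ 2) c)))
        ≡⟨ norm-twice-unit-coefficient d ζ ⟩
      normω d ζ ℤ.* ((+ 3 ℤ.- + 4 ℤ.* normω d ζ) ℤ.* (+ 3 ℤ.- + 4 ℤ.* normω d ζ))
        ≡⟨ cong (λ n → n ℤ.* ((+ 3 ℤ.- + 4 ℤ.* n) ℤ.* (+ 3 ℤ.- + 4 ℤ.* n))) (unit-norm d ζ unit) ⟩
      + 1 ∎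
    edge₂ : Edge d (vertex d w) (vertex d (col (suc (suc k))))
    edge₂ = det≡unit*det-col⇒Edge k w (col (suc (suc k))) (subω (mulω d c (addω oneω (mulω d y x))) y) coefficient-norm (det-absorb-skip² d c x y (col₋ k) (col k))

proposition8 : (d : ℕ) → (d ≡ 1 ⊎ d ≡ 2 ⊎ d ≡ 3 ⊎ d ≡ 7 ⊎ d ≡ 11) →
    (a : ℕ → Zω) → GeodesicExpansion d a →
    (n : ℕ) → 1 ≤ n →
      (normω d (a n) ≢ + 1)
      × (normω d (a n) ≡ + 2 → a (suc n) ≢ negω (conjω d (a n)))
      × ((ζ : Zω) → IsUnit d ζ → a n ≡ scaleω (+ 2) ζ →
           a (suc n) ≢ negω (scaleω (+ 2) (conjω d ζ)))
proposition8 d _ a geodesic (suc k) _ =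
  norm≢1 k , norm≡2⇒next≢-conj k , twice-unit⇒next≢-twice-conj k
  where open GeodesicExpansionProperties geodesic
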